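{- Let $V$ be a $3$-dimensional vector space over a field $K$, equipped with a bracket $[\cdot\,\cdot\,\cdot]$, in the Grassmann–Cayley algebra of step $3$ on $V$ (join $\vee$, meet $\wedge$ as in the context). For vectors $x_1,\dots,x_6\in V$, writing $(a,b,c,a',b',c')=(x_1,\dots,x_6)$, define $$E(x_1,\dots,x_6)=(bc' \wedge b'c) \vee (ca' \wedge c'a) \vee (ab' \wedge a'b)\in K.$$ Then for any six vectors $x_1,\dots,x_6\in V$ and any permutation $\sigma$ of $\{1,\dots,6\}$, $$E(x_{\sigma(1)},\dots,x_{\sigma(6)})\in\{E(x_1,\dots,x_6),\,-E(x_1,\dots,x_6)\},$$ i.e. the expression changes at most in sign under any permutation of the six points.
   Context: Grassmann–Cayley algebra of step $3$: the exterior algebra of a $3$-dimensional vector space $V$ over a field $K$ (vectors represent points of the projective plane), with a fixed bracket $[xyz]$ (a nonzero alternating trilinear form on $V$, e.g. the determinant in a fixed basis). The join $\vee$ is the exterior product; juxtaposition $xy$ denotes the join $x\vee y$ of two vectors (a step-$2$ extensor, representing a line). The join of three vectors is identified with the scalar $x\vee y\vee z=[xyz]$. The meet of two step-$2$ extensors is the vector $$xy \wedge zw = [xyw]\,z - [xyz]\,w.$$ -}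

module Defs where

open import Level using (Level; _⊔_; suc)
open import Algebra.Bundles using (CommutativeRing)
open import Data.Fin using (Fin; #_)
open import Data.Product using (∃; ∃-syntax; _×_)
open import Relation.Nullary using (¬_)

record Field (c ℓ : Level) : Set (suc (c ⊔ ℓ)) where
  field
    commutativeRing : CommutativeRing c ℓ
  open CommutativeRing commutativeRing public
  field
    0≉1     : ¬ (0# ≈ 1#)
    inverse : ∀ x → ¬ (x ≈ 0#) → ∃[ y ] (x * y ≈ 1#)

module GC {κ λ′ : Level} (F : Field κ λ′) where
  open Field F

  V : Set κ
  V = Fin 3 → Carrier

  _≈ᵥ_ : V → V → Set λ′
  u ≈ᵥ v = ∀ i → u i ≈ v i

  _+ᵥ_ : V → V → V
  (u +ᵥ v) i = u i + v i

  _·ᵥ_ : Carrier → V → V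
  (a ·ᵥ v) i = a * v i

  _-ᵥ_ : V → V → V
  (u -ᵥ v) i = u i - v i

  record Bracket : Set (κ ⊔ λ′) where
    field
      br    : V → V → V → Carrier
      cong  : ∀ {x x' y y' z z'} → x ≈ᵥ x' → y ≈ᵥ y' → z ≈ᵥ z' →
              br x y z ≈ br x' y' z'
      lin₁  : ∀ a b u v y z →
              br ((a ·ᵥ u) +ᵥ (b ·ᵥ v)) y z ≈ a * br u y z + b * br v y z
      lin₂  : ∀ a b x u v z →
              br x ((a ·ᵥ u) +ᵥ (b ·ᵥ v)) z ≈ a * br x u z + b * br x v z
      lin₃  : ∀ a b x y u v →
              br x y ((a ·ᵥ u) +ᵥ (b ·ᵥ v)) ≈ a * br x y u + b * br x y v
      alt₁₂ : ∀ x z → br x x z ≈ 0#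
      alt₁₃ : ∀ x y → br x y x ≈ 0#
      alt₂₃ : ∀ x y → br x y y ≈ 0#
      nonzero : ∃[ x ] ∃[ y ] ∃[ z ] ¬ (br x y z ≈ 0#)

  module _ (B : Bracket) where
    open Bracket B

    join₃ : V → V → V → Carrier
    join₃ = br

    meet : V → V → V → V → V
    meet x y z w = (br x y w ·ᵥ z) -ᵥ (br x y z ·ᵥ w)

    E : (Fin 6 → V) → Carrier
    E x = join₃ (meet b c' b' c) (meet c a' c' a) (meet a b' a' b)
      where
        a = x (# 0) ; b = x (# 1) ; c = x (# 2)
        a' = x (# 3) ; b' = x (# 4) ; c' = x (# 5)

-- An alternating trilinear form on K³ is determined by its value D = [e₀e₁e₂] on the
-- standard basis, so the bracket is D · det.  E is therefore a polynomial in D and the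
-- 18 coordinates of the six points, and normalising it shows that E changes sign under
-- each transposition (0 k).  These generate the symmetric group, as (i j) = (0 j)(0 i)(0 j)
-- whenever 0 ≠ i ≠ j, so every permutation multiplies E by ±1.
module Submission where

open import Defs
open import Level using (Level)
open import Data.Fin using (Fin)
open import Data.Fin.Permutation using (Permutation′; _⟨$⟩ʳ_)
open import Data.Sum using (_⊎_)

open import Algebra.Bundles using (CommutativeRing; RawRing)
open import Data.Bool.Base using (T; if_then_else_)
open import Data.Fin.Base as Fin using (combine; remQuot; fromℕ; inject₁)
open import Data.Fin.Patterns using (0F; 1F; 2F; 3F; 4F; 5F)
open import Data.Fin.Permutation using (transpose)
open import Data.Fin.Permutation.Transposition.List using (TranspositionList; eval; decompose; eval-decompose)
open import Data.Fin.Properties using (all?; _≟_)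
open import Data.List.Base using ([]; _∷_)
open import Data.Maybe.Base using (nothing)
open import Data.Nat.Base as ℕ using (ℕ; zero; suc; _∸_; _≡ᵇ_)
open import Data.Nat.Properties using (≡ᵇ⇒≡)
open import Data.Product.Base using (_×_; _,_; swap; uncurry)
open import Data.Sum using (inj₁; inj₂)
open import Data.Vec.Base using (Vec; []; _∷_; _∷ʳ_; tabulate)
open import Function.Base using (_∘_; id)
open import Level using (_⊔_; 0ℓ)
open import Relation.Binary.PropositionalEquality as ≡ using (_≡_; _≢_; _≗_)
open import Relation.Nullary.Decidable using (does; toWitness; yes; no; ¬?; _→-dec_; dec-false)
open import Tactic.RingSolver.Core.AlmostCommutativeRing using (fromCommutativeRing)
open import Tactic.RingSolver.Core.Expression using (Expr; Κ; Ι; _⊕_; _⊗_; _⊛_; ⊝_; module Eval)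
open import Tactic.RingSolver.Core.Polynomial.Parameters using (RawCoeff; Homomorphism)

-- Polynomial normalisation with integer coefficients, an integer being a difference
-- p − n of naturals.  The solver of Tactic.RingSolver over an abstract commutative ring
-- takes its coefficients from the ring itself, where it cannot decide that 1 − 1 = 0.
Diff : Set
Diff = ℕ × ℕ

normalise : Diff → Diff
normalise (p , n) = p ∸ n , n ∸ p

diffRawRing : RawRing 0ℓ 0ℓ
diffRawRing = record
  { Carrier = Diff
  ; _≈_     = _≡_
  ; _+_     = λ (p , n) (p′ , n′) → normalise (p ℕ.+ p′ , n ℕ.+ n′)
  ; _*_     = λ (p , n) (p′ , n′) → normalise (p ℕ.* p′ ℕ.+ n ℕ.* n′ , p ℕ.* n′ ℕ.+ n ℕ.* p′)
  ; -_      = swap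
  ; 0#      = 0 , 0
  ; 1#      = 1 , 0
  }

diffCoeff : RawCoeff 0ℓ 0ℓ
diffCoeff = record { rawRing = diffRawRing ; isZero = λ (p , n) → p ≡ᵇ n }

open import Tactic.RingSolver.Core.Polynomial.Base diffCoeff using (Poly; κ; ι; _⊞_; _⊠_; ⊟_; _⊡_)

norm : ∀ {n} → Expr Diff n → Poly n
norm (Κ c)   = κ c
norm (Ι i)   = ι i
norm (e ⊕ f) = norm e ⊞ norm f
norm (e ⊗ f) = norm e ⊠ norm f
norm (⊝ e)   = ⊟ norm e
norm (e ⊛ k) = norm e ⊡ k

module DiffSolver {c ℓ} (R : CommutativeRing c ℓ) where
  open CommutativeRing R
  open import Algebra.Properties.Semiring.Mult.TCOptimised semiring using (1+×; ×-homo-+; ×1-homo-*) renaming (_×_ to _×ᵣ_)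
  open import Algebra.Properties.AbelianGroup +-abelianGroup using (⁻¹-anti-homo‿-; ⁻¹-∙-comm)
  open import Algebra.Properties.CommutativeSemigroup +-commutativeSemigroup using (interchange)
  open import Algebra.Properties.Ring ring using (-0#≈0#; -‿distribˡ-*; -‿distribʳ-*)
  open import Relation.Binary.Reasoning.Setoid setoid

  -- Normalised pairs have a zero entry, so 0, 1 and -1 evaluate to 0#, 1# and - 1#
  -- definitionally; the coordinate identities below rely on this.
  ⟦_⟧ᵈ : Diff → Carrier
  ⟦ p , zero ⟧ᵈ        = p ×ᵣ 1#
  ⟦ zero , suc n ⟧ᵈ    = - (suc n ×ᵣ 1#)
  ⟦ suc p , suc n ⟧ᵈ   = ⟦ p , n ⟧ᵈ

  ⟦⟧ᵈ-normalise : ∀ x → ⟦ normalise x ⟧ᵈ ≡ ⟦ x ⟧ᵈ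
  ⟦⟧ᵈ-normalise (zero  , zero)  = ≡.refl
  ⟦⟧ᵈ-normalise (zero  , suc n) = ≡.refl
  ⟦⟧ᵈ-normalise (suc p , zero)  = ≡.refl
  ⟦⟧ᵈ-normalise (suc p , suc n) = ⟦⟧ᵈ-normalise (p , n)

  ⟦⟧ᵈ-diagonal : ∀ p → ⟦ p , p ⟧ᵈ ≡ 0#
  ⟦⟧ᵈ-diagonal zero    = ≡.refl
  ⟦⟧ᵈ-diagonal (suc p) = ⟦⟧ᵈ-diagonal p

  -+-interchange : ∀ a b c d → (a - b) + (c - d) ≈ (a + c) - (b + d)
  -+-interchange a b c d = trans (interchange a (- b) c (- d)) (+-congˡ (⁻¹-∙-comm b d))

  -*-expand : ∀ a b c d → (a - b) * (c - d) ≈ (a * c + b * d) - (a * d + b * c)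
  -*-expand a b c d = begin
    (a - b) * (c - d)                   ≈⟨ distribˡ (a - b) c (- d) ⟩
    (a - b) * c + (a - b) * - d         ≈⟨ +-cong (distribʳ c a (- b)) (sym (-‿distribʳ-* (a - b) d)) ⟩
    (a * c + - b * c) + - ((a - b) * d) ≈⟨ +-cong (+-congˡ (sym (-‿distribˡ-* b c))) (-‿cong (distribʳ d a (- b))) ⟩
    (a * c - b * c) - (a * d + - b * d) ≈⟨ +-congˡ (-‿cong (+-congˡ (sym (-‿distribˡ-* b d)))) ⟩
    (a * c - b * c) - (a * d - b * d)   ≈⟨ +-congˡ (⁻¹-anti-homo‿- (a * d) (b * d)) ⟩
    (a * c - b * c) + (b * d - a * d)   ≈⟨ -+-interchange (a * c) (b * c) (b * d) (a * d) ⟩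
    (a * c + b * d) - (b * c + a * d)   ≈⟨ +-congˡ (-‿cong (+-comm (b * c) (a * d))) ⟩
    (a * c + b * d) - (a * d + b * c)   ∎

  ⟦⟧ᵈ-difference : ∀ p n → ⟦ p , n ⟧ᵈ ≈ p ×ᵣ 1# - n ×ᵣ 1#
  ⟦⟧ᵈ-difference p       zero    = sym (trans (+-congˡ -0#≈0#) (+-identityʳ _))
  ⟦⟧ᵈ-difference zero    (suc n) = sym (+-identityˡ _)
  ⟦⟧ᵈ-difference (suc p) (suc n) = begin
    ⟦ p , n ⟧ᵈ                      ≈⟨ ⟦⟧ᵈ-difference p n ⟩
    p ×ᵣ 1# - n ×ᵣ 1#               ≈⟨ +-identityˡ _ ⟨
    0# + (p ×ᵣ 1# - n ×ᵣ 1#)        ≈⟨ +-congʳ (-‿inverseʳ 1#) ⟨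
    (1# - 1#) + (p ×ᵣ 1# - n ×ᵣ 1#) ≈⟨ -+-interchange 1# 1# (p ×ᵣ 1#) (n ×ᵣ 1#) ⟩
    (1# + p ×ᵣ 1#) - (1# + n ×ᵣ 1#) ≈⟨ +-cong (1+× p 1#) (-‿cong (1+× n 1#)) ⟨
    suc p ×ᵣ 1# - suc n ×ᵣ 1#       ∎

  +-homo : ∀ x y → ⟦ RawRing._+_ diffRawRing x y ⟧ᵈ ≈ ⟦ x ⟧ᵈ + ⟦ y ⟧ᵈ
  +-homo (p , n) (p′ , n′) = begin
    ⟦ normalise (p ℕ.+ p′ , n ℕ.+ n′) ⟧ᵈ ≡⟨ ⟦⟧ᵈ-normalise (p ℕ.+ p′ , n ℕ.+ n′) ⟩
    ⟦ p ℕ.+ p′ , n ℕ.+ n′ ⟧ᵈ             ≈⟨ ⟦⟧ᵈ-difference (p ℕ.+ p′) (n ℕ.+ n′) ⟩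
    (p ℕ.+ p′) ×ᵣ 1# - (n ℕ.+ n′) ×ᵣ 1#  ≈⟨ +-cong (×-homo-+ 1# p p′) (-‿cong (×-homo-+ 1# n n′)) ⟩
    (P + P′) - (N + N′)                  ≈⟨ -+-interchange P N P′ N′ ⟨
    (P - N) + (P′ - N′)                  ≈⟨ +-cong (⟦⟧ᵈ-difference p n) (⟦⟧ᵈ-difference p′ n′) ⟨
    ⟦ p , n ⟧ᵈ + ⟦ p′ , n′ ⟧ᵈ            ∎
    where P = p ×ᵣ 1#; N = n ×ᵣ 1#; P′ = p′ ×ᵣ 1#; N′ = n′ ×ᵣ 1#

  *-homo : ∀ x y → ⟦ RawRing._*_ diffRawRing x y ⟧ᵈ ≈ ⟦ x ⟧ᵈ * ⟦ y ⟧ᵈ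
  *-homo (p , n) (p′ , n′) = begin
    ⟦ normalise (pp′ ℕ.+ nn′ , pn′ ℕ.+ np′) ⟧ᵈ ≡⟨ ⟦⟧ᵈ-normalise (pp′ ℕ.+ nn′ , pn′ ℕ.+ np′) ⟩
    ⟦ pp′ ℕ.+ nn′ , pn′ ℕ.+ np′ ⟧ᵈ             ≈⟨ ⟦⟧ᵈ-difference (pp′ ℕ.+ nn′) (pn′ ℕ.+ np′) ⟩
    (pp′ ℕ.+ nn′) ×ᵣ 1# - (pn′ ℕ.+ np′) ×ᵣ 1#  ≈⟨ +-cong (×-homo-+ 1# pp′ nn′) (-‿cong (×-homo-+ 1# pn′ np′)) ⟩
    (pp′ ×ᵣ 1# + nn′ ×ᵣ 1#) - (pn′ ×ᵣ 1# + np′ ×ᵣ 1#)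
      ≈⟨ +-cong (+-cong (×1-homo-* p p′) (×1-homo-* n n′)) (-‿cong (+-cong (×1-homo-* p n′) (×1-homo-* n p′))) ⟩
    (P * P′ + N * N′) - (P * N′ + N * P′)      ≈⟨ -*-expand P N P′ N′ ⟨
    (P - N) * (P′ - N′)                        ≈⟨ *-cong (⟦⟧ᵈ-difference p n) (⟦⟧ᵈ-difference p′ n′) ⟨
    ⟦ p , n ⟧ᵈ * ⟦ p′ , n′ ⟧ᵈ                  ∎
    where
    pp′ = p ℕ.* p′; nn′ = n ℕ.* n′; pn′ = p ℕ.* n′; np′ = n ℕ.* p′
    P = p ×ᵣ 1#; N = n ×ᵣ 1#; P′ = p′ ×ᵣ 1#; N′ = n′ ×ᵣ 1#

  -‿homo : ∀ x → ⟦ swap x ⟧ᵈ ≈ - ⟦ x ⟧ᵈ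
  -‿homo (p , n) = begin
    ⟦ n , p ⟧ᵈ             ≈⟨ ⟦⟧ᵈ-difference n p ⟩
    n ×ᵣ 1# - p ×ᵣ 1#      ≈⟨ ⁻¹-anti-homo‿- (p ×ᵣ 1#) (n ×ᵣ 1#) ⟨
    - (p ×ᵣ 1# - n ×ᵣ 1#)  ≈⟨ -‿cong (⟦⟧ᵈ-difference p n) ⟨
    - ⟦ p , n ⟧ᵈ           ∎

  isZero-sound : ∀ x → T (RawCoeff.isZero diffCoeff x) → 0# ≈ ⟦ x ⟧ᵈ
  isZero-sound (p , n) p≡ᵇn with ≡ᵇ⇒≡ p n p≡ᵇn
  ... | ≡.refl = reflexive (≡.sym (⟦⟧ᵈ-diagonal p))

  homomorphism : Homomorphism 0ℓ 0ℓ c ℓ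
  homomorphism = record
    { from          = diffCoeff
    ; to            = fromCommutativeRing R (λ _ → nothing)
    ; morphism      = record
      { ⟦_⟧    = ⟦_⟧ᵈ
      ; +-homo = +-homo
      ; *-homo = *-homo
      ; -‿homo = -‿homo
      ; 0-homo = refl
      ; 1-homo = refl
      }
    ; Zero-C⟶Zero-R = isZero-sound
    }

  open Eval rawRing ⟦_⟧ᵈ public using (⟦_⟧)
  open import Tactic.RingSolver.Core.Polynomial.Semantics homomorphism using () renaming (⟦_⟧ to ⟦_⟧ₚ)
  open import Tactic.RingSolver.Core.Polynomial.Homomorphism homomorphism using (κ-hom; ι-hom; ⊞-hom; ⊠-hom; ⊟-hom; ⊡-hom)
  open import Algebra.Properties.Semiring.Exp.TCOptimised semiring using (^-congˡ)

  norm-correct : ∀ {n} (e : Expr Diff n) ρ → ⟦ norm e ⟧ₚ ρ ≈ ⟦ e ⟧ ρ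
  norm-correct (Κ c)   ρ = κ-hom c ρ
  norm-correct (Ι i)   ρ = ι-hom i ρ
  norm-correct (e ⊕ f) ρ = trans (⊞-hom (norm e) (norm f) ρ) (+-cong (norm-correct e ρ) (norm-correct f ρ))
  norm-correct (e ⊗ f) ρ = trans (⊠-hom (norm e) (norm f) ρ) (*-cong (norm-correct e ρ) (norm-correct f ρ))
  norm-correct (⊝ e)   ρ = trans (⊟-hom (norm e) ρ) (-‿cong (norm-correct e ρ))
  norm-correct (e ⊛ k) ρ = trans (⊡-hom (norm e) k ρ) (^-congˡ k (norm-correct e ρ))

  prove : ∀ {n} (e₁ e₂ : Expr Diff n) → norm e₁ ≡ norm e₂ → ∀ ρ → ⟦ e₁ ⟧ ρ ≈ ⟦ e₂ ⟧ ρ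
  prove e₁ e₂ eq ρ = begin
    ⟦ e₁ ⟧ ρ         ≈⟨ norm-correct e₁ ρ ⟨
    ⟦ norm e₁ ⟧ₚ ρ   ≡⟨ ≡.cong (λ P → ⟦ P ⟧ₚ ρ) eq ⟩
    ⟦ norm e₂ ⟧ₚ ρ   ≈⟨ norm-correct e₂ ρ ⟩
    ⟦ e₂ ⟧ ρ         ∎

module CoordinateFormulas {r ℓ} (R : RawRing r ℓ) where
  open RawRing R

  Point : Set r
  Point = Fin 3 → Carrier

  Σ₃ : (Fin 3 → Carrier) → Carrier
  Σ₃ f = f 0F + f 1F + f 2F

  det : Point → Point → Point → Carrier
  det u v w = u 0F * (v 1F * w 2F + - (v 2F * w 1F))
            + u 1F * (v 2F * w 0F + - (v 0F * w 2F))
            + u 2F * (v 0F * w 1F + - (v 1F * w 0F))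

  trilinear : (Fin 3 → Fin 3 → Fin 3 → Carrier) → Point → Point → Point → Carrier
  trilinear t u v w = Σ₃ λ i → u i * Σ₃ λ j → v j * Σ₃ λ k → w k * t i j k

  leviCivita : Carrier → Fin 3 → Fin 3 → Fin 3 → Carrier
  leviCivita d 0F 1F 2F = d
  leviCivita d 1F 2F 0F = d
  leviCivita d 2F 0F 1F = d
  leviCivita d 0F 2F 1F = - d
  leviCivita d 2F 1F 0F = - d
  leviCivita d 1F 0F 2F = - d
  leviCivita d _  _  _  = 0#

  bracket : Carrier → Point → Point → Point → Carrier
  bracket d u v w = d * det u v w

  meet : Carrier → Point → Point → Point → Point → Point
  meet d x y z w i = bracket d x y w * z i + - (bracket d x y z * w i)

  E : Carrier → (Fin 6 → Point) → Carrier
  E d x = bracket d (meet d b c′ b′ c) (meet d c a′ c′ a) (meet d a b′ a′ b)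
    where
    a = x 0F; b = x 1F; c = x 2F; a′ = x 3F; b′ = x 4F; c′ = x 5F

exprRawRing : ℕ → RawRing 0ℓ 0ℓ
exprRawRing n = record
  { Carrier = Expr Diff n
  ; _≈_     = _≡_
  ; _+_     = _⊕_
  ; _*_     = _⊗_
  ; -_      = ⊝_
  ; 0#      = Κ (0 , 0)
  ; 1#      = Κ (1 , 0)
  }

-- The scale is the last variable: with it first, normalisation is several times slower.
module Symbolic (m : ℕ) where
  open CoordinateFormulas (exprRawRing (suc (m ℕ.* 3))) public

  scale : Expr Diff (suc (m ℕ.* 3))
  scale = Ι (fromℕ (m ℕ.* 3))

  point : Fin m → Fin 3 → Expr Diff (suc (m ℕ.* 3))
  point k i = Ι (inject₁ (combine k i))

transpose₀ : ∀ {n} → Fin (suc n) → Fin (suc n) → Fin (suc n)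
transpose₀ j = transpose 0F j ⟨$⟩ʳ_

transpose-same : ∀ {n} (i k : Fin n) → transpose i i ⟨$⟩ʳ k ≡ k
transpose-same i k with k ≟ i
... | yes k≡i = ≡.sym k≡i
... | no  k≢i rewrite dec-false (k ≟ i) k≢i = ≡.refl

transpose-conjugate : ∀ (i : Fin 5) (j k : Fin 6) → Fin.suc i ≢ j →
  transpose (Fin.suc i) j ⟨$⟩ʳ k ≡ transpose₀ j (transpose₀ (Fin.suc i) (transpose₀ j k))
transpose-conjugate = toWitness {a? = all? λ i → all? λ j → all? λ k →
  ¬? (Fin.suc i ≟ j) →-dec (transpose (Fin.suc i) j ⟨$⟩ʳ k ≟ transpose₀ j (transpose₀ (Fin.suc i) (transpose₀ j k)))} _

module CoordinateIdentities {c ℓ} (R : CommutativeRing c ℓ) where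
  open CommutativeRing R
  open DiffSolver R
  module C = CoordinateFormulas rawRing
  module S₃ = Symbolic 3
  module S₆ = Symbolic 6

  environment : ∀ {m} → Carrier → (Fin m → Fin 3 → Carrier) → Vec Carrier (suc (m ℕ.* 3))
  environment d x = tabulate (uncurry x ∘ remQuot 3) ∷ʳ d

  trilinear-leviCivita : ∀ d u v w → C.trilinear (C.leviCivita d) u v w ≈ d * C.det u v w
  trilinear-leviCivita d u v w =
    prove (S₃.trilinear (S₃.leviCivita S₃.scale) (p 0F) (p 1F) (p 2F))
          (S₃.scale ⊗ S₃.det (p 0F) (p 1F) (p 2F)) ≡.refl
          (environment {3} d λ { 0F → u; 1F → v; 2F → w })
    where p = S₃.point

  E-permuted : (Fin 6 → Fin 6) → Expr Diff 19
  E-permuted h = S₆.E S₆.scale (S₆.point ∘ h)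

  -- One clause per transposition: the environment lookups only reduce for a concrete permutation.
  E-transpose₀ : ∀ k d x → C.E d (x ∘ transpose₀ (Fin.suc k)) ≈ - C.E d x
  E-transpose₀ 0F d x = prove (E-permuted (transpose₀ 1F)) (⊝ E-permuted id) ≡.refl (environment d x)
  E-transpose₀ 1F d x = prove (E-permuted (transpose₀ 2F)) (⊝ E-permuted id) ≡.refl (environment d x)
  E-transpose₀ 2F d x = prove (E-permuted (transpose₀ 3F)) (⊝ E-permuted id) ≡.refl (environment d x)
  E-transpose₀ 3F d x = prove (E-permuted (transpose₀ 4F)) (⊝ E-permuted id) ≡.refl (environment d x)
  E-transpose₀ 4F d x = prove (E-permuted (transpose₀ 5F)) (⊝ E-permuted id) ≡.refl (environment d x)

module LinearForms {c ℓ} (F : Field c ℓ) where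
  open Field F
  open GC F
  open DiffSolver commutativeRing using (prove)
  private module C = CoordinateFormulas rawRing
  open import Algebra.Properties.Ring ring using (-‿involutive)
  open import Algebra.Properties.Group +-group using (inverseˡ-unique)
  open import Relation.Binary.Reasoning.Setoid setoid

  record IsLinearForm (f : V → Carrier) : Set (c ⊔ ℓ) where
    field
      cong   : ∀ {u v} → u ≈ᵥ v → f u ≈ f v
      linear : ∀ a b u v → f ((a ·ᵥ u) +ᵥ (b ·ᵥ v)) ≈ a * f u + b * f v

    additive : ∀ u v → f (u +ᵥ v) ≈ f u + f v
    additive u v = begin
      f (u +ᵥ v)                 ≈⟨ cong (λ i → +-cong (*-identityˡ (u i)) (*-identityˡ (v i))) ⟨
      f ((1# ·ᵥ u) +ᵥ (1# ·ᵥ v)) ≈⟨ linear 1# 1# u v ⟩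
      1# * f u + 1# * f v        ≈⟨ +-cong (*-identityˡ (f u)) (*-identityˡ (f v)) ⟩
      f u + f v                  ∎

  basis : Fin 3 → V
  basis i j = if does (i ≟ j) then 1# else 0#

  private
    𝟘 𝟙 : Expr Diff 3
    𝟘 = Κ (0 , 0)
    𝟙 = Κ (1 , 0)

  basis-decomposition : ∀ u → u ≈ᵥ ((1# ·ᵥ ((u 0F ·ᵥ basis 0F) +ᵥ (u 1F ·ᵥ basis 1F))) +ᵥ (u 2F ·ᵥ basis 2F))
  basis-decomposition u 0F = prove (Ι 0F) (𝟙 ⊗ (Ι 0F ⊗ 𝟙 ⊕ Ι 1F ⊗ 𝟘) ⊕ Ι 2F ⊗ 𝟘) ≡.refl (u 0F ∷ u 1F ∷ u 2F ∷ [])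
  basis-decomposition u 1F = prove (Ι 1F) (𝟙 ⊗ (Ι 0F ⊗ 𝟘 ⊕ Ι 1F ⊗ 𝟙) ⊕ Ι 2F ⊗ 𝟘) ≡.refl (u 0F ∷ u 1F ∷ u 2F ∷ [])
  basis-decomposition u 2F = prove (Ι 2F) (𝟙 ⊗ (Ι 0F ⊗ 𝟘 ⊕ Ι 1F ⊗ 𝟘) ⊕ Ι 2F ⊗ 𝟙) ≡.refl (u 0F ∷ u 1F ∷ u 2F ∷ [])

  Σ₃-cong : ∀ {f g : Fin 3 → Carrier} → (∀ i → f i ≈ g i) → C.Σ₃ f ≈ C.Σ₃ g
  Σ₃-cong f≈g = +-cong (+-cong (f≈g 0F) (f≈g 1F)) (f≈g 2F)

  linear-expansion : ∀ {f} → IsLinearForm f → ∀ u → f u ≈ C.Σ₃ (λ i → u i * f (basis i))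
  linear-expansion {f} lin u = begin
    f u                                                        ≈⟨ cong (basis-decomposition u) ⟩
    f ((1# ·ᵥ ((u 0F ·ᵥ e 0F) +ᵥ (u 1F ·ᵥ e 1F))) +ᵥ (u 2F ·ᵥ e 2F)) ≈⟨ linear 1# (u 2F) _ (e 2F) ⟩
    1# * f ((u 0F ·ᵥ e 0F) +ᵥ (u 1F ·ᵥ e 1F)) + u 2F * f (e 2F) ≈⟨ +-congʳ (*-identityˡ _) ⟩
    f ((u 0F ·ᵥ e 0F) +ᵥ (u 1F ·ᵥ e 1F)) + u 2F * f (e 2F)      ≈⟨ +-congʳ (linear (u 0F) (u 1F) (e 0F) (e 1F)) ⟩
    C.Σ₃ (λ i → u i * f (e i))                                 ∎
    where open IsLinearForm lin; e = basis

  alternating⇒antisymmetric : (g : V → V → Carrier) →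
    (∀ w → IsLinearForm (λ u → g u w)) → (∀ w → IsLinearForm (g w)) → (∀ x → g x x ≈ 0#) →
    ∀ x y → g x y ≈ - g y x
  alternating⇒antisymmetric g linˡ linʳ alt x y = inverseˡ-unique (g x y) (g y x) (begin
    g x y + g y x                     ≈⟨ +-cong (+-identityˡ _) (+-identityʳ _) ⟨
    (0# + g x y) + (g y x + 0#)       ≈⟨ +-cong (+-congʳ (alt x)) (+-congˡ (alt y)) ⟨
    (g x x + g x y) + (g y x + g y y) ≈⟨ +-cong (additiveʳ x x y) (additiveʳ y x y) ⟨
    g x (x +ᵥ y) + g y (x +ᵥ y)       ≈⟨ additiveˡ (x +ᵥ y) x y ⟨
    g (x +ᵥ y) (x +ᵥ y)               ≈⟨ alt (x +ᵥ y) ⟩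
    0#                                ∎)
    where
    additiveˡ = λ w → IsLinearForm.additive (linˡ w)
    additiveʳ = λ w → IsLinearForm.additive (linʳ w)

  ≈-neg-trans : ∀ {a b c} → a ≈ - b → b ≈ - c → a ≈ c
  ≈-neg-trans {c = c} a≈-b b≈-c = trans a≈-b (trans (-‿cong b≈-c) (-‿involutive c))

module BracketCoordinates {c ℓ} (F : Field c ℓ) (B : GC.Bracket F) where
  open Field F
  open GC F
  open Bracket B renaming (cong to br-cong)
  open LinearForms F
  open CoordinateIdentities commutativeRing using (trilinear-leviCivita)
  module C = CoordinateFormulas rawRing
  open import Relation.Binary.Reasoning.Setoid setoid

  private
    reflᵥ : ∀ {u} → u ≈ᵥ u
    reflᵥ _ = refl

  br-linear₁ : ∀ v w → IsLinearForm (λ u → br u v w)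
  br-linear₁ v w = record { cong = λ p → br-cong p reflᵥ reflᵥ ; linear = λ a b x y → lin₁ a b x y v w }

  br-linear₂ : ∀ u w → IsLinearForm (λ v → br u v w)
  br-linear₂ u w = record { cong = λ p → br-cong reflᵥ p reflᵥ ; linear = λ a b x y → lin₂ a b u x y w }

  br-linear₃ : ∀ u v → IsLinearForm (br u v)
  br-linear₃ u v = record { cong = λ p → br-cong reflᵥ reflᵥ p ; linear = λ a b x y → lin₃ a b u v x y }

  br-swap₁₂ : ∀ x y z → br x y z ≈ - br y x z
  br-swap₁₂ x y z = alternating⇒antisymmetric (λ u v → br u v z) (λ v → br-linear₁ v z) (λ u → br-linear₂ u z) (λ u → alt₁₂ u z) x y

  br-swap₂₃ : ∀ x y z → br x y z ≈ - br x z y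
  br-swap₂₃ x y z = alternating⇒antisymmetric (br x) (br-linear₂ x) (br-linear₃ x) (alt₂₃ x) y z

  br-swap₁₃ : ∀ x y z → br x y z ≈ - br z y x
  br-swap₁₃ x y z = alternating⇒antisymmetric (λ u w → br u y w) (λ w → br-linear₁ y w) (λ u → br-linear₃ u y) (λ u → alt₁₃ u y) x z

  D : Carrier
  D = br (basis 0F) (basis 1F) (basis 2F)

  br-basis : ∀ i j k → br (basis i) (basis j) (basis k) ≈ C.leviCivita D i j k
  br-basis 0F 0F _  = alt₁₂ _ _
  br-basis 1F 1F _  = alt₁₂ _ _
  br-basis 2F 2F _  = alt₁₂ _ _
  br-basis 0F 1F 0F = alt₁₃ _ _
  br-basis 0F 1F 1F = alt₂₃ _ _
  br-basis 0F 1F 2F = refl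
  br-basis 0F 2F 0F = alt₁₃ _ _
  br-basis 0F 2F 1F = br-swap₂₃ _ _ _
  br-basis 0F 2F 2F = alt₂₃ _ _
  br-basis 1F 0F 0F = alt₂₃ _ _
  br-basis 1F 0F 1F = alt₁₃ _ _
  br-basis 1F 0F 2F = br-swap₁₂ _ _ _
  br-basis 1F 2F 0F = ≈-neg-trans (br-swap₁₂ _ _ _) (br-swap₁₃ _ _ _)
  br-basis 1F 2F 1F = alt₁₃ _ _
  br-basis 1F 2F 2F = alt₂₃ _ _
  br-basis 2F 0F 0F = alt₂₃ _ _
  br-basis 2F 0F 1F = ≈-neg-trans (br-swap₁₂ _ _ _) (br-swap₂₃ _ _ _)
  br-basis 2F 0F 2F = alt₁₃ _ _
  br-basis 2F 1F 0F = br-swap₁₃ _ _ _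
  br-basis 2F 1F 1F = alt₂₃ _ _
  br-basis 2F 1F 2F = alt₁₃ _ _

  br-coordinates : ∀ u v w → br u v w ≈ D * C.det u v w
  br-coordinates u v w = begin
    br u v w                                    ≈⟨ linear-expansion (br-linear₁ v w) u ⟩
    C.Σ₃ (λ i → u i * br (basis i) v w)         ≈⟨ Σ₃-cong (λ i → *-congˡ {u i} (expand₂ i)) ⟩
    C.trilinear (C.leviCivita D) u v w          ≈⟨ trilinear-leviCivita D u v w ⟩
    D * C.det u v w                             ∎
    where
    expand₃ : ∀ i j → br (basis i) (basis j) w ≈ C.Σ₃ (λ k → w k * C.leviCivita D i j k)
    expand₃ i j = trans (linear-expansion (br-linear₃ (basis i) (basis j)) w)
                      (Σ₃-cong λ k → *-congˡ {w k} (br-basis i j k))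
    expand₂ : ∀ i → br (basis i) v w ≈ C.Σ₃ (λ j → v j * C.Σ₃ (λ k → w k * C.leviCivita D i j k))
    expand₂ i = trans (linear-expansion (br-linear₂ (basis i) w) v)
                    (Σ₃-cong λ j → *-congˡ {v j} (expand₃ i j))

  meet-coordinates : ∀ x y z w → meet B x y z w ≈ᵥ C.meet D x y z w
  meet-coordinates x y z w i = +-cong (*-congʳ (br-coordinates x y w)) (-‿cong (*-congʳ (br-coordinates x y z)))

  E-coordinates : ∀ x → E B x ≈ C.E D x
  E-coordinates x = trans (br-cong (meet-coordinates _ _ _ _) (meet-coordinates _ _ _ _) (meet-coordinates _ _ _ _))
                          (br-coordinates _ _ _)

module SignInvariance {c ℓ} (F : Field c ℓ) (B : GC.Bracket F) where
  open Field F
  open GC F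
  open Bracket B renaming (cong to br-cong)
  open LinearForms F using (≈-neg-trans)
  open BracketCoordinates F B using (D; E-coordinates)
  open CoordinateIdentities commutativeRing using (E-transpose₀)
  module C = CoordinateFormulas rawRing
  open import Relation.Binary.Reasoning.Setoid setoid

  meet-cong : ∀ {x x′ y y′ z z′ w w′} → x ≈ᵥ x′ → y ≈ᵥ y′ → z ≈ᵥ z′ → w ≈ᵥ w′ →
              meet B x y z w ≈ᵥ meet B x′ y′ z′ w′
  meet-cong x≈ y≈ z≈ w≈ i = +-cong (*-cong (br-cong x≈ y≈ w≈) (z≈ i)) (-‿cong (*-cong (br-cong x≈ y≈ z≈) (w≈ i)))

  E-cong : ∀ {x y : Fin 6 → V} → (∀ k → x k ≈ᵥ y k) → E B x ≈ E B y
  E-cong x≈y = br-cong (meet-cong (x≈y 1F) (x≈y 5F) (x≈y 4F) (x≈y 2F))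
                       (meet-cong (x≈y 2F) (x≈y 3F) (x≈y 5F) (x≈y 0F))
                       (meet-cong (x≈y 0F) (x≈y 4F) (x≈y 3F) (x≈y 1F))

  infix 4 _≈±_
  _≈±_ : Carrier → Carrier → Set ℓ
  a ≈± b = a ≈ b ⊎ a ≈ - b

  ≈±-trans : ∀ {a b c} → a ≈± b → b ≈± c → a ≈± c
  ≈±-trans (inj₁ p) (inj₁ q) = inj₁ (trans p q)
  ≈±-trans (inj₁ p) (inj₂ q) = inj₂ (trans p q)
  ≈±-trans (inj₂ p) (inj₁ q) = inj₂ (trans p (-‿cong q))
  ≈±-trans (inj₂ p) (inj₂ q) = inj₁ (≈-neg-trans p q)

  record SignInvariant (h : Fin 6 → Fin 6) : Set (c ⊔ ℓ) where
    constructor signInvariant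
    field E-≈± : ∀ x → E B (x ∘ h) ≈± E B x
  open SignInvariant

  signInvariant-id : SignInvariant id
  signInvariant-id = signInvariant λ x → inj₁ refl

  signInvariant-∘ : ∀ {f g} → SignInvariant f → SignInvariant g → SignInvariant (f ∘ g)
  signInvariant-∘ {f} sf sg = signInvariant λ x → ≈±-trans (E-≈± sg (x ∘ f)) (E-≈± sf x)

  signInvariant-cong : ∀ {f g} → f ≗ g → SignInvariant f → SignInvariant g
  signInvariant-cong f≗g sf = signInvariant λ x →
    ≈±-trans (inj₁ (E-cong λ k i → reflexive (≡.cong (λ m → x m i) (≡.sym (f≗g k))))) (E-≈± sf x)

  transpose₀-signInvariant : ∀ j → SignInvariant (transpose₀ j)
  transpose₀-signInvariant 0F          = signInvariant λ x → inj₁ refl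
  transpose₀-signInvariant (Fin.suc k) = signInvariant λ x → inj₂ (begin
    E B (x ∘ t)   ≈⟨ E-coordinates (x ∘ t) ⟩
    C.E D (x ∘ t) ≈⟨ E-transpose₀ k D x ⟩
    - C.E D x     ≈⟨ -‿cong (E-coordinates x) ⟨
    - E B x       ∎)
    where t = transpose₀ (Fin.suc k)

  transpose-signInvariant : ∀ i j → SignInvariant (transpose i j ⟨$⟩ʳ_)
  transpose-signInvariant 0F          j = transpose₀-signInvariant j
  transpose-signInvariant (Fin.suc i) j with Fin.suc i ≟ j
  ... | yes ≡.refl = signInvariant-cong (≡.sym ∘ transpose-same (Fin.suc i)) signInvariant-id
  ... | no  i≢j    = signInvariant-cong (λ k → ≡.sym (transpose-conjugate i j k i≢j))
                       (signInvariant-∘ (signInvariant-∘ ⟨0j⟩ (transpose₀-signInvariant (Fin.suc i))) ⟨0j⟩)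
    where ⟨0j⟩ = transpose₀-signInvariant j

  eval-signInvariant : ∀ (L : TranspositionList 6) → SignInvariant (eval L ⟨$⟩ʳ_)
  eval-signInvariant []            = signInvariant-id
  eval-signInvariant ((i , j) ∷ L) = signInvariant-∘ (eval-signInvariant L) (transpose-signInvariant i j)

  permutation-signInvariant : ∀ (σ : Permutation′ 6) → SignInvariant (σ ⟨$⟩ʳ_)
  permutation-signInvariant σ = signInvariant-cong (eval-decompose σ) (eval-signInvariant (decompose σ))

proposition2 : ∀ {c ℓ : Level} (F : Field c ℓ) (B : GC.Bracket F) →
    let open Field F in
    (x : Fin 6 → GC.V F) (σ : Permutation′ 6) →
    (GC.E F B (λ i → x (σ ⟨$⟩ʳ i)) ≈ GC.E F B x)
      ⊎ (GC.E F B (λ i → x (σ ⟨$⟩ʳ i)) ≈ - GC.E F B x)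
proposition2 F B x σ = SignInvariant.E-≈± (permutation-signInvariant σ) x
  where open SignInvariance F B
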